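{- Let $n \geq 1$ and let $G$ be the hypertree $HT(n)$. Then the total domination number of $G$ is $$\gamma_t(G) = \begin{cases} \frac{1}{7}(2^{n+2}+3) & \text{if } n\equiv 0 \pmod 3,\\ \frac{1}{7}(2^{n+2}-1)+1 & \text{if } n\equiv 1 \pmod 3,\\ \frac{2}{7}(2^{n+1}-1) & \text{if } n\equiv 2 \pmod 3.\end{cases}$$
   Context: The hypertree $HT(n)$ has vertex set $\{1,2,\dots,2^{n+1}-1\}$. Its edges are the edges of the complete binary tree of height $n$ in which vertex $x$ has children $2x$ and $2x+1$ (the root is $1$, at level $0$; vertex $v$ lies at level $i$ iff $2^i \le v \le 2^{i+1}-1$), together with horizontal edges: for each level $i\ge 1$, two vertices at level $i$ are adjacent if their labels differ by $2^{i-1}$. A set $S\subseteq V(G)$ is a total dominating set if every vertex of $V(G)$ is adjacent to some vertex of $S$; $\gamma_t(G)$ is the minimum cardinality of a total dominating set. -}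

module Defs where

open import Data.Nat using (ℕ; zero; suc; _+_; _*_; _∸_; _^_; _≤_; _<_)
open import Data.Nat.DivMod using (_/_; _%_)
open import Data.Product using (_×_; ∃-syntax)
open import Data.Sum using (_⊎_)
open import Data.List using (List; length)
open import Data.List.Membership.Propositional using (_∈_)
open import Data.List.Relation.Unary.Unique.Propositional using (Unique)
open import Relation.Binary.PropositionalEquality using (_≡_)

IsVertex : ℕ → ℕ → Set
IsVertex n v = 1 ≤ v × v ≤ 2 ^ (suc n) ∸ 1

AtLevel : ℕ → ℕ → Set
AtLevel i v = 2 ^ i ≤ v × v < 2 ^ (suc i)

TreeEdge : ℕ → ℕ → Set
TreeEdge x y = y ≡ 2 * x ⊎ y ≡ 2 * x + 1

-- horizontal edge at level i ≥ 1 (written with i = suc j): labels differ by 2^(i-1)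
HorizEdge : ℕ → ℕ → Set
HorizEdge u v = ∃[ j ] (AtLevel (suc j) u × AtLevel (suc j) v
                        × (v ≡ u + 2 ^ j ⊎ u ≡ v + 2 ^ j))

Adj : ℕ → ℕ → ℕ → Set
Adj n u v = IsVertex n u × IsVertex n v
            × (TreeEdge u v ⊎ TreeEdge v u ⊎ HorizEdge u v)

IsTDS : ℕ → List ℕ → Set
IsTDS n S = (∀ s → s ∈ S → IsVertex n s)
          × (∀ v → IsVertex n v → ∃[ s ] (s ∈ S × Adj n v s))

TotalDominationNumber : ℕ → ℕ → Set
TotalDominationNumber n k =
  (∃[ S ] (Unique S × IsTDS n S × length S ≡ k))
  × (∀ S → Unique S → IsTDS n S → k ≤ length S)

-- the claimed value, by n mod 3 (all divisions are exact)
γtFormula : ℕ → ℕ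
γtFormula n with n % 3
... | 0 = (2 ^ (n + 2) + 3) / 7
... | 1 = (2 ^ (n + 2) ∸ 1) / 7 + 1
... | _ = (2 * (2 ^ (n + 1) ∸ 1)) / 7

module Submission where

open import Defs
open import Data.Bool using (Bool; true; false; T; not; _∧_; _∨_)
open import Data.Bool.Properties using (T-∧; T-∨)
open import Data.Empty using (⊥; ⊥-elim)
open import Data.List using (List; []; _∷_; [_]; _++_; length)
open import Data.List.Properties using (length-++)
open import Data.List.Membership.Propositional using (_∈_; _∉_)
open import Data.List.Membership.Propositional.Properties using (∈-++⁺ˡ; ∈-++⁺ʳ; ∈-++⁻; ∈-∃++)
open import Data.List.Relation.Unary.Any using (here; there)
open import Data.List.Relation.Unary.All using () renaming (lookup to all-lookup)
open import Data.List.Relation.Unary.All.Properties using (¬Any⇒All¬)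
open import Data.List.Relation.Unary.AllPairs using ([]; _∷_)
open import Data.List.Relation.Unary.Unique.Propositional using (Unique)
open import Data.List.Relation.Unary.Unique.Propositional.Properties using (++⁺)
open import Data.Nat
open import Data.Nat.DivMod using (_/_; _%_; m*n/n≡m; %-distribˡ-+)
open import Data.Nat.Properties
open import Data.List.Membership.DecPropositional _≟_ using (_∈?_)
open import Data.Nat.Tactic.RingSolver using (solve-∀)
open import Data.Product using (_×_; _,_; proj₁; proj₂; ∃-syntax)
open import Data.Sum using (_⊎_; inj₁; inj₂) renaming (map to ⊎-map)
open import Data.Unit using (tt)
open import Data.Vec using (Vec; []; _∷_)
open import Function.Bundles using (Equivalence)
open import Relation.Binary.Definitions using (tri<; tri≈; tri>)
open import Relation.Binary.PropositionalEquality hiding ([_])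
open import Relation.Nullary using (¬_; yes; no; isYes)
open import Relation.Nullary.Decidable using (fromWitness; toWitness)

-- Apart from the root 1, the vertices of HT(n) pair up into horizontal rungs
-- {a, a + 2^j} at the levels j+1 = 1 … n.  The rungs form a complete binary
-- tree of height n-1: the children of {a, b} are {2a, 2b} and {2a+1, 2b+1};
-- a is adjacent to b, to its parent and to its children, and likewise b; the
-- root is adjacent to the top rung {2, 3}.  Hence a vertex set is a root flag
-- plus a "ladder" (two flags per rung), and total domination becomes the local
-- condition `Covered`.
--
-- With base (h+1) =
-- 2 base h + cost (h mod 3), every covered ladder of height h weighs at least
-- base h + slack, where the slack depends on h mod 3 and the flags of the top
-- rung and its parent; the induction step is a finite check over the flags
-- (`lowerBound`).  A 3-periodic ladder attains the bound (`upperBound`), and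
-- `formula` identifies base h + rootCost with the claimed closed form.

bit : Bool → ℕ
bit true = 1
bit false = 0

_⇒ᵇ_ : Bool → Bool → Bool
a ⇒ᵇ b = not a ∨ b

⇒ᵇ-elim : ∀ {a b} → T (a ⇒ᵇ b) → T a → T b
⇒ᵇ-elim {true} p _ = p

-- `allFlags k f` decides a property of k flags by enumerating all 2^k cases;
-- it turns the finite case analyses of the paper into computations.
allFlags : ∀ k → (Vec Bool k → Bool) → Bool
allFlags zero f = f []
allFlags (suc k) f = allFlags k (λ v → f (false ∷ v)) ∧ allFlags k (λ v → f (true ∷ v))

allFlags-sound : ∀ k f → T (allFlags k f) → ∀ v → T (f v)
allFlags-sound zero f p [] = p
allFlags-sound (suc k) f p (false ∷ v) = allFlags-sound k _ (proj₁ (Equivalence.to T-∧ p)) v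
allFlags-sound (suc k) f p (true ∷ v) = allFlags-sound k _ (proj₂ (Equivalence.to T-∧ p)) v

-- Ladders.  A ladder of height h labels the rungs of a complete binary tree
-- of height h with two flags each: is the left end (A) / right end (B) selected.
data Ladder : ℕ → Set where
  leaf : (sA sB : Bool) → Ladder 0
  node : ∀ {h} (sA sB : Bool) (left right : Ladder h) → Ladder (suc h)

topA topB : ∀ {h} → Ladder h → Bool
topA (leaf sA _) = sA
topA (node sA _ _ _) = sA
topB (leaf _ sB) = sB
topB (node _ sB _ _) = sB

weight : ∀ {h} → Ladder h → ℕ
weight (leaf sA sB) = bit sA + bit sB
weight (node sA sB t u) = bit sA + bit sB + (weight t + weight u)

-- the ends of a rung with flags sA sB are dominated, given the flags pA pB of
-- the parent rung and whether some child A-end (cA) / B-end (cB) is selected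
covers : (pA pB sA sB cA cB : Bool) → Bool
covers pA pB sA sB cA cB = (pA ∨ sB ∨ cA) ∧ (pB ∨ sA ∨ cB)

Covered : ∀ {h} → Bool → Bool → Ladder h → Set
Covered pA pB (leaf sA sB) = T (covers pA pB sA sB false false)
Covered pA pB (node sA sB t u) =
  T (covers pA pB sA sB (topA t ∨ topA u) (topB t ∨ topB u)) × Covered sA sB t × Covered sA sB u

data Phase : Set where
  ph0 ph1 ph2 : Phase

next : Phase → Phase
next ph0 = ph1
next ph1 = ph2
next ph2 = ph0

phase : ℕ → Phase
phase zero = ph0
phase (suc h) = next (phase h)

cost : Phase → ℕ
cost ph0 = 2
cost ph1 = 0
cost ph2 = 0

-- the guaranteed weight of a covered ladder of height h, up to the slack
base : ℕ → ℕ
base zero = 0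
base (suc h) = base h + base h + cost (phase h)

-- extra weight forced by the flags of the top rung (sA sB) and its parent (pA pB)
slack : Phase → (pA pB sA sB : Bool) → ℕ
slack ph0 false false sA sB = 2
slack ph0 true true sA sB = bit sA + bit sB
slack ph0 true false sA sB = 1 + bit sB
slack ph0 false true sA sB = 1 + bit sA
slack ph1 pA pB sA sB = 2 ∸ (bit sA + bit sB)
slack ph2 pA pB sA sB = bit sA + bit sB

leaf-slack : ∀ pA pB sA sB → T (covers pA pB sA sB false false) → slack ph0 pA pB sA sB ≤ bit sA + bit sB
leaf-slack pA pB sA sB c = ≤ᵇ⇒≤ _ _ (⇒ᵇ-elim (allFlags-sound 4 check tt (pA ∷ pB ∷ sA ∷ sB ∷ [])) c)
  where
  check : Vec Bool 4 → Bool
  check (pA ∷ pB ∷ sA ∷ sB ∷ []) =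
    covers pA pB sA sB false false ⇒ᵇ (slack ph0 pA pB sA sB ≤ᵇ bit sA + bit sB)

step-slack : ∀ r pA pB sA sB a₁ b₁ a₂ b₂ → T (covers pA pB sA sB (a₁ ∨ a₂) (b₁ ∨ b₂)) →
             slack (next r) pA pB sA sB + cost r
               ≤ bit sA + bit sB + (slack r sA sB a₁ b₁ + slack r sA sB a₂ b₂)
step-slack r pA pB sA sB a₁ b₁ a₂ b₂ c =
  ≤ᵇ⇒≤ _ _ (⇒ᵇ-elim (valid r (pA ∷ pB ∷ sA ∷ sB ∷ a₁ ∷ b₁ ∷ a₂ ∷ b₂ ∷ [])) c)
  where
  check : Phase → Vec Bool 8 → Bool
  check r (pA ∷ pB ∷ sA ∷ sB ∷ a₁ ∷ b₁ ∷ a₂ ∷ b₂ ∷ []) =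
    covers pA pB sA sB (a₁ ∨ a₂) (b₁ ∨ b₂) ⇒ᵇ
    (slack (next r) pA pB sA sB + cost r ≤ᵇ bit sA + bit sB + (slack r sA sB a₁ b₁ + slack r sA sB a₂ b₂))
  valid : ∀ r v → T (check r v)
  valid ph0 = allFlags-sound 8 (check ph0) tt
  valid ph1 = allFlags-sound 8 (check ph1) tt
  valid ph2 = allFlags-sound 8 (check ph2) tt

regroup : ∀ d c o → d + d + c + o ≡ (o + c) + (d + d)
regroup = solve-∀

distribute : ∀ s o₁ o₂ d → (s + (o₁ + o₂)) + (d + d) ≡ s + ((d + o₁) + (d + o₂))
distribute = solve-∀

x+[y+z]≡y+[x+z] : ∀ x y z → x + (y + z) ≡ y + (x + z)
x+[y+z]≡y+[x+z] = solve-∀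

lowerBound : ∀ {h} pA pB (t : Ladder h) → Covered pA pB t →
             base h + slack (phase h) pA pB (topA t) (topB t) ≤ weight t
lowerBound pA pB (leaf sA sB) c = leaf-slack pA pB sA sB c
lowerBound {suc h} pA pB (node sA sB t u) (c , ct , cu) = begin
  base h + base h + cost (phase h) + slack (phase (suc h)) pA pB sA sB
    ≡⟨ regroup (base h) (cost (phase h)) (slack (phase (suc h)) pA pB sA sB) ⟩
  (slack (next (phase h)) pA pB sA sB + cost (phase h)) + (base h + base h)
    ≤⟨ +-monoˡ-≤ (base h + base h) (step-slack (phase h) pA pB sA sB (topA t) (topB t) (topA u) (topB u) c) ⟩
  (bit sA + bit sB + (slack (phase h) sA sB (topA t) (topB t) + slack (phase h) sA sB (topA u) (topB u))) + (base h + base h)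
    ≡⟨ distribute (bit sA + bit sB) (slack (phase h) sA sB (topA t) (topB t)) _ (base h) ⟩
  bit sA + bit sB + ((base h + slack (phase h) sA sB (topA t) (topB t)) + (base h + slack (phase h) sA sB (topA u) (topB u)))
    ≤⟨ +-monoʳ-≤ (bit sA + bit sB) (+-mono-≤ (lowerBound sA sB t ct) (lowerBound sA sB u cu)) ⟩
  weight (node sA sB t u) ∎
  where open ≤-Reasoning

childFlag : Phase → Bool
childFlag ph0 = false
childFlag ph1 = true
childFlag ph2 = false

periodic : (h : ℕ) → Bool → Bool → Ladder h
periodic zero sA sB = leaf sA sB
periodic (suc h) sA sB =
  node sA sB (periodic h (childFlag (phase h)) (childFlag (phase h)))
             (periodic h (childFlag (phase h)) (childFlag (phase h)))

topA-periodic : ∀ h sA sB → topA (periodic h sA sB) ≡ sA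
topA-periodic zero sA sB = refl
topA-periodic (suc h) sA sB = refl

topB-periodic : ∀ h sA sB → topB (periodic h sA sB) ≡ sB
topB-periodic zero sA sB = refl
topB-periodic (suc h) sA sB = refl

-- the top-rung flags for which the periodic ladder attains the lower bound
Admissible : Phase → (pA pB sA sB : Bool) → Bool
Admissible ph0 pA pB sA sB = pA ∧ pB ∧ not sB
Admissible ph1 pA pB sA sB = sA ∧ sB
Admissible ph2 pA pB sA sB = true

leaf-exact : ∀ pA pB sA sB → T (Admissible ph0 pA pB sA sB) →
             T (covers pA pB sA sB false false) × bit sA + bit sB ≡ slack ph0 pA pB sA sB
leaf-exact pA pB sA sB a =
  let c , e = Equivalence.to T-∧ (⇒ᵇ-elim (allFlags-sound 4 check tt (pA ∷ pB ∷ sA ∷ sB ∷ [])) a)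
  in c , sym (≡ᵇ⇒≡ _ _ e)
  where
  check : Vec Bool 4 → Bool
  check (pA ∷ pB ∷ sA ∷ sB ∷ []) =
    Admissible ph0 pA pB sA sB ⇒ᵇ (covers pA pB sA sB false false ∧ (slack ph0 pA pB sA sB ≡ᵇ bit sA + bit sB))

step-exact : ∀ r pA pB sA sB → T (Admissible (next r) pA pB sA sB) →
             T (Admissible r sA sB (childFlag r) (childFlag r))
             × T (covers pA pB sA sB (childFlag r ∨ childFlag r) (childFlag r ∨ childFlag r))
             × slack (next r) pA pB sA sB + cost r
                 ≡ bit sA + bit sB + (slack r sA sB (childFlag r) (childFlag r) + slack r sA sB (childFlag r) (childFlag r))
step-exact r pA pB sA sB a =
  let ad , rest = Equivalence.to T-∧ (⇒ᵇ-elim (valid r (pA ∷ pB ∷ sA ∷ sB ∷ [])) a)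
      cv , e = Equivalence.to T-∧ rest
  in ad , cv , ≡ᵇ⇒≡ _ _ e
  where
  check : Phase → Vec Bool 4 → Bool
  check r (pA ∷ pB ∷ sA ∷ sB ∷ []) = let c = childFlag r in
    Admissible (next r) pA pB sA sB ⇒ᵇ
    (Admissible r sA sB c c ∧ covers pA pB sA sB (c ∨ c) (c ∨ c)
     ∧ (slack (next r) pA pB sA sB + cost r ≡ᵇ bit sA + bit sB + (slack r sA sB c c + slack r sA sB c c)))
  valid : ∀ r v → T (check r v)
  valid ph0 = allFlags-sound 4 (check ph0) tt
  valid ph1 = allFlags-sound 4 (check ph1) tt
  valid ph2 = allFlags-sound 4 (check ph2) tt

upperBound : ∀ h pA pB sA sB → T (Admissible (phase h) pA pB sA sB) →
             Covered pA pB (periodic h sA sB) × weight (periodic h sA sB) ≡ base h + slack (phase h) pA pB sA sB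
upperBound zero pA pB sA sB a = leaf-exact pA pB sA sB a
upperBound (suc h) pA pB sA sB a
  with step-exact (phase h) pA pB sA sB a | upperBound h sA sB (childFlag (phase h)) (childFlag (phase h))
... | ad , cv , e | below
  rewrite topA-periodic h (childFlag (phase h)) (childFlag (phase h))
        | topB-periodic h (childFlag (phase h)) (childFlag (phase h)) =
  (cv , proj₁ (below ad) , proj₁ (below ad)) , (begin
    bit sA + bit sB + (weight t + weight t)
      ≡⟨ cong (λ w → bit sA + bit sB + (w + w)) (proj₂ (below ad)) ⟩
    bit sA + bit sB + ((base h + s) + (base h + s))
      ≡⟨ sym (distribute (bit sA + bit sB) s s (base h)) ⟩
    (bit sA + bit sB + (s + s)) + (base h + base h)
      ≡⟨ cong (_+ (base h + base h)) (sym e) ⟩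
    (slack (phase (suc h)) pA pB sA sB + cost (phase h)) + (base h + base h)
      ≡⟨ sym (regroup (base h) (cost (phase h)) (slack (phase (suc h)) pA pB sA sB)) ⟩
    base (suc h) + slack (phase (suc h)) pA pB sA sB ∎)
  where
  open ≡-Reasoning
  t : Ladder h
  t = periodic h (childFlag (phase h)) (childFlag (phase h))
  s : ℕ
  s = slack (phase h) sA sB (childFlag (phase h)) (childFlag (phase h))

-- The root 1 is adjacent exactly to 2 and 3, the ends of the top rung; its
-- flag rb is the parent flag of both ends.
rootCost : Phase → ℕ
rootCost ph0 = 2
rootCost ph1 = 0
rootCost ph2 = 1

root-slack : ∀ r rb sA sB → T (sA ∨ sB) → rootCost r ≤ bit rb + slack r rb rb sA sB
root-slack r rb sA sB d = ≤ᵇ⇒≤ _ _ (⇒ᵇ-elim (valid r (rb ∷ sA ∷ sB ∷ [])) d)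
  where
  check : Phase → Vec Bool 3 → Bool
  check r (rb ∷ sA ∷ sB ∷ []) = (sA ∨ sB) ⇒ᵇ (rootCost r ≤ᵇ bit rb + slack r rb rb sA sB)
  valid : ∀ r v → T (check r v)
  valid ph0 = allFlags-sound 3 (check ph0) tt
  valid ph1 = allFlags-sound 3 (check ph1) tt
  valid ph2 = allFlags-sound 3 (check ph2) tt

ladder-lowerBound : ∀ {h} rb (t : Ladder h) → T (topA t ∨ topB t) → Covered rb rb t →
                    base h + rootCost (phase h) ≤ bit rb + weight t
ladder-lowerBound {h} rb t d c = begin
  base h + rootCost (phase h)                                 ≤⟨ +-monoʳ-≤ (base h) (root-slack (phase h) rb _ _ d) ⟩
  base h + (bit rb + slack (phase h) rb rb (topA t) (topB t)) ≡⟨ x+[y+z]≡y+[x+z] (base h) (bit rb) _ ⟩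
  bit rb + (base h + slack (phase h) rb rb (topA t) (topB t)) ≤⟨ +-monoʳ-≤ (bit rb) (lowerBound rb rb t c) ⟩
  bit rb + weight t ∎
  where open ≤-Reasoning

rootFlag topFlagB : Phase → Bool
rootFlag ph0 = true
rootFlag ph1 = false
rootFlag ph2 = false
topFlagB ph0 = false
topFlagB ph1 = true
topFlagB ph2 = false

root-admissible : ∀ r → T (Admissible r (rootFlag r) (rootFlag r) true (topFlagB r))
root-admissible ph0 = tt
root-admissible ph1 = tt
root-admissible ph2 = tt

root-exact : ∀ r → bit (rootFlag r) + slack r (rootFlag r) (rootFlag r) true (topFlagB r) ≡ rootCost r
root-exact ph0 = refl
root-exact ph1 = refl
root-exact ph2 = refl

ladder-optimum : ∀ h → let r = phase h; t = periodic h true (topFlagB r) in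
                 T (topA t ∨ topB t) × Covered (rootFlag r) (rootFlag r) t
                 × bit (rootFlag r) + weight t ≡ base h + rootCost r
ladder-optimum h rewrite topA-periodic h true (topFlagB (phase h)) =
  let c , w = upperBound h _ _ _ _ (root-admissible r) in
  tt , c , (begin
    bit (rootFlag r) + weight (periodic h true (topFlagB r))
      ≡⟨ cong (bit (rootFlag r) +_) w ⟩
    bit (rootFlag r) + (base h + slack r (rootFlag r) (rootFlag r) true (topFlagB r))
      ≡⟨ x+[y+z]≡y+[x+z] (bit (rootFlag r)) (base h) _ ⟩
    base h + (bit (rootFlag r) + slack r (rootFlag r) (rootFlag r) true (topFlagB r))
      ≡⟨ cong (base h +_) (root-exact r) ⟩
    base h + rootCost r ∎)
  where
  open ≡-Reasoning
  r : Phase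
  r = phase h

-- Arithmetic: base h + rootCost (phase h) is the claimed closed form at n = h + 1.
-- First, 7 · base h falls short of 2^(h+3) by an amount depending only on the phase
shortfall : Phase → ℕ
shortfall ph0 = 8
shortfall ph1 = 2
shortfall ph2 = 4

closedForm : ∀ h → 7 * base h + shortfall (phase h) ≡ 2 ^ (3 + h)
closedForm zero = refl
closedForm (suc h) = begin
  7 * (d + d + c) + shortfall (next r) ≡⟨ rearrange d c _ ⟩
  2 * (7 * d) + (7 * c + shortfall (next r)) ≡⟨ cong (2 * (7 * d) +_) (step r) ⟩
  2 * (7 * d) + 2 * shortfall r ≡⟨ sym (*-distribˡ-+ 2 (7 * d) (shortfall r)) ⟩
  2 * (7 * d + shortfall r) ≡⟨ cong (2 *_) (closedForm h) ⟩
  2 ^ (3 + suc h) ∎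
  where
  open ≡-Reasoning
  r : Phase
  r = phase h
  d c : ℕ
  d = base h
  c = cost r
  rearrange : ∀ d c s → 7 * (d + d + c) + s ≡ 2 * (7 * d) + (7 * c + s)
  rearrange = solve-∀
  step : ∀ r → 7 * cost r + shortfall (next r) ≡ 2 * shortfall r
  step ph0 = refl
  step ph1 = refl
  step ph2 = refl

residue : Phase → ℕ
residue ph0 = 0
residue ph1 = 1
residue ph2 = 2

phase-mod3 : ∀ h → h % 3 ≡ residue (phase h)
phase-mod3 zero = refl
phase-mod3 (suc h) = begin
  (1 + h) % 3                  ≡⟨ %-distribˡ-+ 1 h 3 ⟩
  (1 + h % 3) % 3              ≡⟨ cong (λ m → (1 + m) % 3) (phase-mod3 h) ⟩
  (1 + residue (phase h)) % 3  ≡⟨ step (phase h) ⟩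
  residue (next (phase h))     ∎
  where
  open ≡-Reasoning
  step : ∀ r → (1 + residue r) % 3 ≡ residue (next r)
  step ph0 = refl
  step ph1 = refl
  step ph2 = refl

formula-at : ∀ h r → phase h ≡ r → 7 * base h + shortfall r ≡ 2 ^ (3 + h) →
             γtFormula (suc h) ≡ base h + rootCost r
formula-at h ph0 e cf rewrite phase-mod3 (suc h) | e = begin
  (2 ^ (suc h + 2) ∸ 1) / 7 + 1 ≡⟨ cong (λ m → (2 ^ m ∸ 1) / 7 + 1) (+-comm (suc h) 2) ⟩
  (2 ^ (3 + h) ∸ 1) / 7 + 1     ≡⟨ cong (λ m → (m ∸ 1) / 7 + 1) (sym cf) ⟩
  (7 * d + 8 ∸ 1) / 7 + 1       ≡⟨ cong (λ m → m / 7 + 1) (+-∸-assoc (7 * d) {8} {1} (s≤s z≤n)) ⟩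
  (7 * d + 7) / 7 + 1           ≡⟨ cong (λ m → m / 7 + 1) (factor d) ⟩
  (d + 1) * 7 / 7 + 1           ≡⟨ cong (_+ 1) (m*n/n≡m (d + 1) 7) ⟩
  d + 1 + 1                     ≡⟨ +-assoc d 1 1 ⟩
  d + 2                         ∎
  where
  open ≡-Reasoning
  d : ℕ
  d = base h
  factor : ∀ d → 7 * d + 7 ≡ (d + 1) * 7
  factor = solve-∀
formula-at h ph1 e cf rewrite phase-mod3 (suc h) | e = begin
  2 * (2 ^ (suc h + 1) ∸ 1) / 7 ≡⟨ cong (λ m → 2 * (2 ^ m ∸ 1) / 7) (+-comm (suc h) 1) ⟩
  2 * (2 ^ (2 + h) ∸ 1) / 7     ≡⟨ cong (_/ 7) (*-distribˡ-∸ 2 (2 ^ (2 + h)) 1) ⟩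
  (2 ^ (3 + h) ∸ 2) / 7         ≡⟨ cong (λ m → (m ∸ 2) / 7) (sym cf) ⟩
  (7 * d + 2 ∸ 2) / 7           ≡⟨ cong (_/ 7) (m+n∸n≡m (7 * d) 2) ⟩
  7 * d / 7                     ≡⟨ cong (_/ 7) (*-comm 7 d) ⟩
  d * 7 / 7                     ≡⟨ m*n/n≡m d 7 ⟩
  d                             ≡⟨ sym (+-identityʳ d) ⟩
  d + 0                         ∎
  where
  open ≡-Reasoning
  d : ℕ
  d = base h
formula-at h ph2 e cf rewrite phase-mod3 (suc h) | e = begin
  (2 ^ (suc h + 2) + 3) / 7 ≡⟨ cong (λ m → (2 ^ m + 3) / 7) (+-comm (suc h) 2) ⟩
  (2 ^ (3 + h) + 3) / 7     ≡⟨ cong (λ m → (m + 3) / 7) (sym cf) ⟩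
  (7 * d + 4 + 3) / 7       ≡⟨ cong (_/ 7) (factor d) ⟩
  (d + 1) * 7 / 7           ≡⟨ m*n/n≡m (d + 1) 7 ⟩
  d + 1                     ∎
  where
  open ≡-Reasoning
  d : ℕ
  d = base h
  factor : ∀ d → 7 * d + 4 + 3 ≡ (d + 1) * 7
  factor = solve-∀

formula : ∀ h → γtFormula (suc h) ≡ base h + rootCost (phase h)
formula h = formula-at h (phase h) refl (closedForm h)

⌊2n/2⌋≡n : ∀ n → ⌊ 2 * n /2⌋ ≡ n
⌊2n/2⌋≡n n = sym (trans (n≡⌊n+n/2⌋ n) (cong (λ m → ⌊ n + m /2⌋) (sym (+-identityʳ n))))

⌊2n+1/2⌋≡n : ∀ n → ⌊ 2 * n + 1 /2⌋ ≡ n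
⌊2n+1/2⌋≡n n = trans (cong ⌊_/2⌋ (+-comm (2 * n) 1)) (odd n)
  where
  odd : ∀ n → ⌊ suc (2 * n) /2⌋ ≡ n
  odd zero = refl
  odd (suc n) = cong suc (trans (cong ⌊_/2⌋ (+-suc n (n + 0))) (odd n))

parent : ∀ {p x} → TreeEdge p x → ⌊ x /2⌋ ≡ p
parent {p} (inj₁ refl) = ⌊2n/2⌋≡n p
parent {p} (inj₂ refl) = ⌊2n+1/2⌋≡n p

parent-unique : ∀ {p q x} → TreeEdge p x → TreeEdge q x → p ≡ q
parent-unique e e′ = trans (sym (parent e)) (parent e′)

even-odd : ∀ {y} u v → y ≡ 2 * u → y ≡ 2 * v + 1 → ⊥
even-odd u v e o = even≢odd u v (trans (sym e) (trans o (+-comm (2 * v) 1)))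

halve-split : ∀ y → y ≡ 2 * ⌊ y /2⌋ ⊎ y ≡ 2 * ⌊ y /2⌋ + 1
halve-split 0 = inj₁ refl
halve-split 1 = inj₂ refl
halve-split (suc (suc y)) with halve-split y
... | inj₁ e = inj₁ (trans (cong (2 +_) e) (sym (*-suc 2 ⌊ y /2⌋)))
... | inj₂ e = inj₂ (trans (cong (2 +_) e) (trans (sym (+-assoc 2 (2 * ⌊ y /2⌋) 1)) (cong (_+ 1) (sym (*-suc 2 ⌊ y /2⌋)))))

level-unique : ∀ {i m x} → AtLevel i x → AtLevel m x → i ≡ m
level-unique {i} {m} (lo-i , hi-i) (lo-m , hi-m) with <-cmp i m
... | tri≈ _ e _ = e
... | tri< i<m _ _ = ⊥-elim (<-irrefl refl (<-≤-trans hi-i (≤-trans (^-monoʳ-≤ 2 i<m) lo-m)))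
... | tri> _ _ m<i = ⊥-elim (<-irrefl refl (<-≤-trans hi-m (≤-trans (^-monoʳ-≤ 2 m<i) lo-i)))

level⇒vertex : ∀ {n i x} → i ≤ n → AtLevel i x → IsVertex n x
level⇒vertex {i = i} i≤n (lo , hi) =
  ≤-trans (m^n>0 2 i) lo , <⇒≤pred (<-≤-trans hi (^-monoʳ-≤ 2 (s≤s i≤n)))

vertex⇒bound : ∀ {n x} → IsVertex n x → x < 2 ^ suc n
vertex⇒bound {n} (_ , hi) = m≤pred[n]⇒suc[m]≤n {{>-nonZero (m^n>0 2 (suc n))}} hi

root-vertex : ∀ n → IsVertex n 1
root-vertex n = s≤s z≤n , <⇒≤pred (^-monoʳ-≤ 2 {1} {suc n} (s≤s z≤n))

-- A rung at level j+1: the horizontal edge {a, b} with b = a + 2^j.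
record Rung (j a b : ℕ) : Set where
  field
    left-lo  : 2 ^ suc j ≤ a
    right≡   : b ≡ a + 2 ^ j
    right-hi : b < 2 ^ suc (suc j)
open Rung public

topRung : Rung 0 2 3
topRung = record { left-lo = ≤-refl ; right≡ = refl ; right-hi = ≤-refl }

module _ {j a b : ℕ} (ρ : Rung j a b) where

  left≤right : a ≤ b
  left≤right = subst (a ≤_) (sym (right≡ ρ)) (m≤m+n a (2 ^ j))

  levelA : AtLevel (suc j) a
  levelA = left-lo ρ , ≤-<-trans left≤right (right-hi ρ)

  levelB : AtLevel (suc j) b
  levelB = ≤-trans (left-lo ρ) left≤right , right-hi ρ

  left≢right : a ≢ b
  left≢right e = <-irrefl (trans e (right≡ ρ)) (m<m+n a (m^n>0 2 j))

  childRung₀ : Rung (suc j) (2 * a) (2 * b)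
  childRung₀ = record
    { left-lo  = *-monoʳ-≤ 2 (left-lo ρ)
    ; right≡   = trans (cong (2 *_) (right≡ ρ)) (*-distribˡ-+ 2 a (2 ^ j))
    ; right-hi = *-monoʳ-< 2 (right-hi ρ) }

  childRung₁ : Rung (suc j) (2 * a + 1) (2 * b + 1)
  childRung₁ = record
    { left-lo  = ≤-trans (*-monoʳ-≤ 2 (left-lo ρ)) (m≤m+n (2 * a) 1)
    ; right≡   = trans (cong (λ m → 2 * m + 1) (right≡ ρ)) (shift a (2 ^ j))
    ; right-hi = subst (_≤ 2 ^ suc (suc (suc j))) (odd b) (*-monoʳ-≤ 2 (right-hi ρ)) }
    where
    shift : ∀ a p → 2 * (a + p) + 1 ≡ 2 * a + 1 + 2 * p
    shift = solve-∀
    odd : ∀ b → 2 * suc b ≡ suc (2 * b + 1)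
    odd = solve-∀

-- A rung of HT(n) with h further levels of rungs below it; pa and pb are the
-- parents of its ends.
record RungIn (n h j a b pa pb : ℕ) : Set where
  field
    rung     : Rung j a b
    height   : suc j + h ≡ n
    parentA  : TreeEdge pa a
    parentB  : TreeEdge pb b
    vertexPA : IsVertex n pa
    vertexPB : IsVertex n pb
open RungIn public

topRungIn : ∀ h → RungIn (suc h) h 0 2 3 1 1
topRungIn h = record
  { rung = topRung ; height = refl ; parentA = inj₁ refl ; parentB = inj₂ refl
  ; vertexPA = root-vertex (suc h) ; vertexPB = root-vertex (suc h) }

module _ {n h j a b pa pb : ℕ} (ι : RungIn n h j a b pa pb) where

  private
    j<n : suc j ≤ n
    j<n = subst (suc j ≤_) (height ι) (m≤m+n (suc j) h)

  vertexA : IsVertex n a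
  vertexA = level⇒vertex j<n (levelA (rung ι))

  vertexB : IsVertex n b
  vertexB = level⇒vertex j<n (levelB (rung ι))

  horizontalAB : HorizEdge a b
  horizontalAB = j , levelA (rung ι) , levelB (rung ι) , inj₁ (right≡ (rung ι))

  horizontalBA : HorizEdge b a
  horizontalBA = j , levelB (rung ι) , levelA (rung ι) , inj₂ (right≡ (rung ι))

  neighboursA : ∀ {s} → TreeEdge a s ⊎ TreeEdge s a ⊎ HorizEdge a s → TreeEdge a s ⊎ s ≡ pa ⊎ s ≡ b
  neighboursA (inj₁ c) = inj₁ c
  neighboursA (inj₂ (inj₁ p)) = inj₂ (inj₁ (parent-unique p (parentA ι)))
  neighboursA {s} (inj₂ (inj₂ (i , la , ls , d))) with level-unique {suc i} {suc j} la (levelA (rung ι))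
  ... | refl with d
  ... | inj₁ e = inj₂ (inj₂ (trans e (sym (right≡ (rung ι)))))
  ... | inj₂ e = ⊥-elim (<-irrefl refl (<-≤-trans (right-hi (rung ι)) (begin
    2 ^ suc (suc j)     ≡⟨ quadruple (2 ^ j) ⟩
    2 * (2 ^ j) + 2 ^ j + 2 ^ j ≤⟨ +-monoˡ-≤ (2 ^ j) (+-monoˡ-≤ (2 ^ j) (proj₁ ls)) ⟩
    s + 2 ^ j + 2 ^ j   ≡⟨ cong (_+ 2 ^ j) (sym e) ⟩
    a + 2 ^ j           ≡⟨ sym (right≡ (rung ι)) ⟩
    b                   ∎)))
    where
    open ≤-Reasoning
    quadruple : ∀ q → 2 * (2 * q) ≡ 2 * q + q + q
    quadruple = solve-∀

  neighboursB : ∀ {s} → TreeEdge b s ⊎ TreeEdge s b ⊎ HorizEdge b s → TreeEdge b s ⊎ s ≡ pb ⊎ s ≡ a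
  neighboursB (inj₁ c) = inj₁ c
  neighboursB (inj₂ (inj₁ p)) = inj₂ (inj₁ (parent-unique p (parentB ι)))
  neighboursB {s} (inj₂ (inj₂ (i , lb , ls , d))) with level-unique {suc i} {suc j} lb (levelB (rung ι))
  ... | refl with d
  ... | inj₂ e = inj₂ (inj₂ (+-cancelʳ-≡ (2 ^ j) s a (trans (sym e) (right≡ (rung ι)))))
  ... | inj₁ e = ⊥-elim (<-irrefl refl (<-≤-trans (proj₂ ls) (begin
    2 ^ suc (suc j)     ≡⟨ quadruple (2 ^ j) ⟩
    2 * (2 ^ j) + 2 ^ j + 2 ^ j ≤⟨ +-monoˡ-≤ (2 ^ j) (+-monoˡ-≤ (2 ^ j) (left-lo (rung ι))) ⟩
    a + 2 ^ j + 2 ^ j   ≡⟨ cong (_+ 2 ^ j) (sym (right≡ (rung ι))) ⟩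
    b + 2 ^ j           ≡⟨ sym e ⟩
    s                   ∎)))
    where
    open ≤-Reasoning
    quadruple : ∀ q → 2 * (2 * q) ≡ 2 * q + q + q
    quadruple = solve-∀

  childRungIn₀ : ∀ {h′} → h ≡ suc h′ → RungIn n h′ (suc j) (2 * a) (2 * b) a b
  childRungIn₀ {h′} refl = record
    { rung = childRung₀ (rung ι) ; height = trans (sym (+-suc (suc j) h′)) (height ι)
    ; parentA = inj₁ refl ; parentB = inj₁ refl ; vertexPA = vertexA ; vertexPB = vertexB }

  childRungIn₁ : ∀ {h′} → h ≡ suc h′ → RungIn n h′ (suc j) (2 * a + 1) (2 * b + 1) a b
  childRungIn₁ {h′} refl = record
    { rung = childRung₁ (rung ι) ; height = trans (sym (+-suc (suc j) h′)) (height ι)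
    ; parentA = inj₂ refl ; parentB = inj₂ refl ; vertexPA = vertexA ; vertexPB = vertexB }

  bottom-childless : ∀ {x s} → h ≡ 0 → AtLevel (suc j) x → IsVertex n s → ¬ TreeEdge x s
  bottom-childless {x} {s} refl (lo , _) vs c = <-irrefl refl (<-≤-trans (vertex⇒bound {n} vs) (begin
    2 ^ suc n       ≡⟨ cong (λ m → 2 ^ suc m) (sym (trans (sym (+-identityʳ (suc j))) (height ι))) ⟩
    2 * 2 ^ suc j   ≤⟨ *-monoʳ-≤ 2 lo ⟩
    2 * x           ≤⟨ below c ⟩
    s               ∎))
    where
    open ≤-Reasoning
    below : TreeEdge x s → 2 * x ≤ s
    below (inj₁ e) = ≤-reflexive (sym e)
    below (inj₂ e) = subst (2 * x ≤_) (sym e) (m≤m+n (2 * x) 1)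

onlyIf : Bool → ℕ → List ℕ
onlyIf true x = [ x ]
onlyIf false x = []

onlyIf-∈ : ∀ s a {x} rest → x ∈ onlyIf s a ++ rest → (x ≡ a × T s) ⊎ x ∈ rest
onlyIf-∈ true a rest (here e) = inj₁ (e , tt)
onlyIf-∈ true a rest (there p) = inj₂ p
onlyIf-∈ false a rest p = inj₂ p

∈-onlyIf : ∀ {s} a rest → T s → a ∈ onlyIf s a ++ rest
∈-onlyIf {true} a rest _ = here refl

onlyIf-⊇ : ∀ s a {x} rest → x ∈ rest → x ∈ onlyIf s a ++ rest
onlyIf-⊇ true a rest p = there p
onlyIf-⊇ false a rest p = p

length-onlyIf : ∀ s a rest → length (onlyIf s a ++ rest) ≡ bit s + length rest
length-onlyIf true a rest = refl
length-onlyIf false a rest = refl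

unique-onlyIf : ∀ s {a R} → a ∉ R → Unique R → Unique (onlyIf s a ++ R)
unique-onlyIf true a∉R u = ¬Any⇒All¬ _ a∉R ∷ u
unique-onlyIf false a∉R u = u

members lower : ∀ {h} → ℕ → ℕ → Ladder h → List ℕ
members a b t = onlyIf (topA t) a ++ onlyIf (topB t) b ++ lower a b t
lower a b (leaf _ _) = []
lower a b (node _ _ t u) = members (2 * a) (2 * b) t ++ members (2 * a + 1) (2 * b + 1) u

members-∈ : ∀ {h a b x} (t : Ladder h) → x ∈ members a b t →
            (x ≡ a × T (topA t)) ⊎ (x ≡ b × T (topB t)) ⊎ x ∈ lower a b t
members-∈ {a = a} {b} t p with onlyIf-∈ (topA t) a _ p
... | inj₁ e = inj₁ e
... | inj₂ q = inj₂ (onlyIf-∈ (topB t) b _ q)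

∈-membersA : ∀ {h a b} (t : Ladder h) → T (topA t) → a ∈ members a b t
∈-membersA {a = a} t s = ∈-onlyIf a _ s

∈-membersB : ∀ {h a b} (t : Ladder h) → T (topB t) → b ∈ members a b t
∈-membersB {a = a} {b} t s = onlyIf-⊇ (topA t) a _ (∈-onlyIf b _ s)

lower⊆members : ∀ {h a b x} (t : Ladder h) → x ∈ lower a b t → x ∈ members a b t
lower⊆members {a = a} {b} t p = onlyIf-⊇ (topA t) a _ (onlyIf-⊇ (topB t) b _ p)

length-members : ∀ {h a b} (t : Ladder h) → length (members a b t) ≡ weight t
length-members {a = a} {b} t = begin
  length (members a b t)                                    ≡⟨ length-onlyIf (topA t) a _ ⟩
  bit (topA t) + length (onlyIf (topB t) b ++ lower a b t)  ≡⟨ cong (bit (topA t) +_) (length-onlyIf (topB t) b _) ⟩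
  bit (topA t) + (bit (topB t) + length (lower a b t))      ≡⟨ sym (+-assoc (bit (topA t)) _ _) ⟩
  bit (topA t) + bit (topB t) + length (lower a b t)        ≡⟨ lower-weight t ⟩
  weight t                                                  ∎
  where
  open ≡-Reasoning
  lower-weight : ∀ {h} (t : Ladder h) → bit (topA t) + bit (topB t) + length (lower a b t) ≡ weight t
  lower-weight (leaf sA sB) = +-identityʳ _
  lower-weight (node sA sB t u) = cong (bit sA + bit sB +_) (begin
    length (members (2 * a) (2 * b) t ++ members (2 * a + 1) (2 * b + 1) u)
      ≡⟨ length-++ (members (2 * a) (2 * b) t) ⟩
    length (members (2 * a) (2 * b) t) + length (members (2 * a + 1) (2 * b + 1) u)
      ≡⟨ cong₂ _+_ (length-members t) (length-members u) ⟩
    weight t + weight u ∎)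

ancestor : ℕ → ℕ → ℕ
ancestor zero x = x
ancestor (suc k) x = ⌊ ancestor k x /2⌋

Below : (j a b h x : ℕ) → Set
Below j a b h x = ∃[ k ] (k ≤ h × AtLevel (suc j + k) x × (ancestor k x ≡ a ⊎ ancestor k x ≡ b))

below-top : ∀ {j a b h x} → AtLevel (suc j) x → x ≡ a ⊎ x ≡ b → Below j a b h x
below-top {j} {x = x} lv e = 0 , z≤n , subst (λ m → AtLevel m x) (sym (+-identityʳ (suc j))) lv , e

below-child : ∀ {j a b c d h x} → TreeEdge a c → TreeEdge b d → Below (suc j) c d h x → Below j a b (suc h) x
below-child {j} {x = x} ea eb (k , k≤h , lv , anc) =
  suc k , s≤s k≤h , subst (λ m → AtLevel m x) (sym (+-suc (suc j) k)) lv ,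
  ⊎-map (λ e → trans (cong ⌊_/2⌋ e) (parent ea)) (λ e → trans (cong ⌊_/2⌋ e) (parent eb)) anc

members-below : ∀ {h j a b x} (t : Ladder h) → Rung j a b → x ∈ members a b t → Below j a b h x
lower-below : ∀ {h j a b x} (t : Ladder h) → Rung j a b → x ∈ lower a b t → Below j a b h x

members-below {h} {j} t ρ p with members-∈ t p
... | inj₁ (refl , _) = below-top {j} {h = h} (levelA ρ) (inj₁ refl)
... | inj₂ (inj₁ (refl , _)) = below-top {j} {h = h} (levelB ρ) (inj₂ refl)
... | inj₂ (inj₂ q) = lower-below t ρ q

lower-below {j = j} {a} {b} (node _ _ t u) ρ q with ∈-++⁻ (members _ _ t) q
... | inj₁ q₀ = below-child {j} {a} {b} (inj₁ refl) (inj₁ refl) (members-below t (childRung₀ ρ) q₀)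
... | inj₂ q₁ = below-child {j} {a} {b} (inj₂ refl) (inj₂ refl) (members-below u (childRung₁ ρ) q₁)

members-vertex : ∀ {n h j a b x} (t : Ladder h) → Rung j a b → suc j + h ≤ n →
                 x ∈ members a b t → IsVertex n x
members-vertex {j = j} t ρ bound p with members-below t ρ p
... | k , k≤h , lv , _ = level⇒vertex (≤-trans (+-monoʳ-≤ (suc j) k≤h) bound) lv

lower-avoids : ∀ {h j a b x} (t : Ladder h) → Rung j a b → AtLevel (suc j) x → x ∉ lower a b t
lower-avoids {j = j} {x = x} (node _ _ t u) ρ lv q with ∈-++⁻ (members _ _ t) q
... | inj₁ q₀ = deeper (members-below t (childRung₀ ρ) q₀)
  where
  deeper : ∀ {c d h} → ¬ Below (suc j) c d h x
  deeper (k , _ , lv′ , _) = m≢1+m+n (suc j) (level-unique {suc j} {suc (suc j) + k} lv lv′)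
... | inj₂ q₁ = deeper (members-below u (childRung₁ ρ) q₁)
  where
  deeper : ∀ {c d h} → ¬ Below (suc j) c d h x
  deeper (k , _ , lv′ , _) = m≢1+m+n (suc j) (level-unique {suc j} {suc (suc j) + k} lv lv′)

children-disjoint : ∀ {h j a b x} (t u : Ladder h) → Rung j a b →
                    ¬ (x ∈ members (2 * a) (2 * b) t × x ∈ members (2 * a + 1) (2 * b + 1) u)
children-disjoint {j = j} {a} {b} {x} t u ρ (p , q)
  with members-below t (childRung₀ ρ) p | members-below u (childRung₁ ρ) q
... | k , _ , lv , anc₀ | k′ , _ , lv′ , anc₁
  with +-cancelˡ-≡ (suc (suc j)) k k′ (level-unique {suc (suc j) + k} {suc (suc j) + k′} lv lv′)
... | refl = even-vs-odd anc₀ anc₁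
  where
  even-vs-odd : ∀ {y} → y ≡ 2 * a ⊎ y ≡ 2 * b → ¬ (y ≡ 2 * a + 1 ⊎ y ≡ 2 * b + 1)
  even-vs-odd (inj₁ e) (inj₁ o) = even-odd a a e o
  even-vs-odd (inj₁ e) (inj₂ o) = even-odd a b e o
  even-vs-odd (inj₂ e) (inj₁ o) = even-odd b a e o
  even-vs-odd (inj₂ e) (inj₂ o) = even-odd b b e o

members-unique : ∀ {h j a b} (t : Ladder h) → Rung j a b → Unique (members a b t)
members-unique {a = a} {b} t ρ =
  unique-onlyIf (topA t) a∉ (unique-onlyIf (topB t) (lower-avoids t ρ (levelB ρ)) (lower-unique t ρ))
  where
  a∉ : a ∉ onlyIf (topB t) b ++ lower a b t
  a∉ p with onlyIf-∈ (topB t) b _ p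
  ... | inj₁ (a≡b , _) = left≢right ρ a≡b
  ... | inj₂ q = lower-avoids t ρ (levelA ρ) q
  lower-unique : ∀ {h j a b} (t : Ladder h) → Rung j a b → Unique (lower a b t)
  lower-unique (leaf _ _) ρ = []
  lower-unique (node _ _ t u) ρ =
    ++⁺ (members-unique t (childRung₀ ρ)) (members-unique u (childRung₁ ρ)) (children-disjoint t u ρ)

root∉members : ∀ {h} (t : Ladder h) → 1 ∉ members 2 3 t
root∉members t p with members-below t topRung p
... | k , _ , (lo , _) , _ = <-irrefl refl (<-≤-trans (^-monoʳ-≤ 2 {1} {suc k} (s≤s z≤n)) lo)

unique-⊆-length : ∀ {xs ys : List ℕ} → Unique xs → (∀ {x} → x ∈ xs → x ∈ ys) → length xs ≤ length ys
unique-⊆-length {[]} u sub = z≤n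
unique-⊆-length {x ∷ xs} {ys} (x∉xs ∷ u) sub with ∈-∃++ (sub (here refl))
... | ys₁ , ys₂ , refl = subst (suc (length xs) ≤_) (sym split) (s≤s (unique-⊆-length u sub′))
  where
  split : length (ys₁ ++ x ∷ ys₂) ≡ suc (length (ys₁ ++ ys₂))
  split rewrite length-++ ys₁ {x ∷ ys₂} | length-++ ys₁ {ys₂} = +-suc (length ys₁) (length ys₂)
  sub′ : ∀ {y} → y ∈ xs → y ∈ ys₁ ++ ys₂
  sub′ p with ∈-++⁻ ys₁ (sub (there p))
  ... | inj₁ q = ∈-++⁺ˡ q
  ... | inj₂ (here e) = ⊥-elim (all-lookup x∉xs p (sym e))
  ... | inj₂ (there q) = ∈-++⁺ʳ ys₁ q

-- The full ladder lists every vertex below its top rung.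
full : (h : ℕ) → Ladder h
full zero = leaf true true
full (suc h) = node true true (full h) (full h)

full-topA : ∀ h → T (topA (full h))
full-topA zero = tt
full-topA (suc h) = tt

full-topB : ∀ h → T (topB (full h))
full-topB zero = tt
full-topB (suc h) = tt

child-of-half : ∀ {y a} → ⌊ y /2⌋ ≡ a → y ≡ 2 * a ⊎ y ≡ 2 * a + 1
child-of-half {y} refl = halve-split y

below⇒full : ∀ h k {a b x} → k ≤ h → ancestor k x ≡ a ⊎ ancestor k x ≡ b → x ∈ members a b (full h)
below⇒full h zero _ (inj₁ refl) = ∈-membersA (full h) (full-topA h)
below⇒full h zero _ (inj₂ refl) = ∈-membersB (full h) (full-topB h)
below⇒full (suc h) (suc k) {a} {b} {x} (s≤s k≤h) anc = lower⊆members (full (suc h)) (descend anc)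
  where
  left right : List ℕ
  left  = members (2 * a) (2 * b) (full h)
  right = members (2 * a + 1) (2 * b + 1) (full h)
  descend : ancestor (suc k) x ≡ a ⊎ ancestor (suc k) x ≡ b → x ∈ left ++ right
  descend (inj₁ e) with child-of-half e
  ... | inj₁ e₀ = ∈-++⁺ˡ (below⇒full h k k≤h (inj₁ e₀))
  ... | inj₂ e₁ = ∈-++⁺ʳ left (below⇒full h k k≤h (inj₁ e₁))
  descend (inj₂ e) with child-of-half e
  ... | inj₁ e₀ = ∈-++⁺ˡ (below⇒full h k k≤h (inj₂ e₀))
  ... | inj₂ e₁ = ∈-++⁺ʳ left (below⇒full h k k≤h (inj₂ e₁))

ancestor-halve : ∀ k x → ancestor k ⌊ x /2⌋ ≡ ⌊ ancestor k x /2⌋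
ancestor-halve zero x = refl
ancestor-halve (suc k) x = cong ⌊_/2⌋ (ancestor-halve k x)

below-top-rung : ∀ m v → 2 ≤ v → v < 2 ^ suc (suc m) → ∃[ k ] (k ≤ m × (ancestor k v ≡ 2 ⊎ ancestor k v ≡ 3))
below-top-rung m v 2≤v v< with v <? 4
... | yes v<4 = 0 , z≤n , two-or-three v 2≤v v<4
  where
  two-or-three : ∀ v → 2 ≤ v → v < 4 → v ≡ 2 ⊎ v ≡ 3
  two-or-three 2 _ _ = inj₁ refl
  two-or-three 3 _ _ = inj₂ refl
  two-or-three 1 (s≤s ()) _
  two-or-three (suc (suc (suc (suc _)))) _ (s≤s (s≤s (s≤s (s≤s ()))))
below-top-rung zero v 2≤v v< | no v≮4 = ⊥-elim (v≮4 v<)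
below-top-rung (suc m) v 2≤v v< | no v≮4
  with below-top-rung m ⌊ v /2⌋ (⌊n/2⌋-mono (≮⇒≥ v≮4)) (*-cancelˡ-< 2 _ _ (≤-<-trans (double-half≤ v) v<))
  where
  double-half≤ : ∀ v → 2 * ⌊ v /2⌋ ≤ v
  double-half≤ v with halve-split v
  ... | inj₁ e = ≤-reflexive (sym e)
  ... | inj₂ e = ≤-trans (m≤m+n _ 1) (≤-reflexive (sym e))
... | k , k≤m , anc = suc k , s≤s k≤m , subst (λ y → y ≡ 2 ⊎ y ≡ 3) (ancestor-halve k v) anc

Dominated : ℕ → List ℕ → ℕ → Set
Dominated n S v = ∃[ s ] (s ∈ S × Adj n v s)

∨-introˡ : ∀ {x y} → T x → T (x ∨ y)
∨-introˡ p = Equivalence.from T-∨ (inj₁ p)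

∨-introʳ : ∀ {x y} → T y → T (x ∨ y)
∨-introʳ p = Equivalence.from T-∨ (inj₂ p)

root-neighbours : ∀ {n s} → IsVertex n s → TreeEdge 1 s ⊎ TreeEdge s 1 ⊎ HorizEdge 1 s → s ≡ 2 ⊎ s ≡ 3
root-neighbours _ (inj₁ c) = c
root-neighbours (1≤s , _) (inj₂ (inj₁ p)) = ⊥-elim (<-irrefl (parent p) 1≤s)
root-neighbours _ (inj₂ (inj₂ (i , (lo , _) , _))) = ⊥-elim (<-irrefl refl (<-≤-trans (^-monoʳ-≤ 2 {1} {suc i} (s≤s z≤n)) lo))

-- Lower bound: any total dominating set S of HT(h+1), restricted to the
-- rungs, is a covered ladder of weight at most |S| - [1 ∈ S].
module Restriction (n : ℕ) (S : List ℕ) where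

  inS : ℕ → Bool
  inS x = isYes (x ∈? S)

  inS-sound : ∀ {x} → T (inS x) → x ∈ S
  inS-sound {x} = toWitness {a? = x ∈? S}

  inS-complete : ∀ {s x} → s ∈ S → s ≡ x → T (inS x)
  inS-complete {x = x} p refl = fromWitness {a? = x ∈? S} p

  restrict : (h : ℕ) → ℕ → ℕ → Ladder h
  restrict zero a b = leaf (inS a) (inS b)
  restrict (suc h) a b = node (inS a) (inS b) (restrict h (2 * a) (2 * b)) (restrict h (2 * a + 1) (2 * b + 1))

  topA-restrict : ∀ h a b → topA (restrict h a b) ≡ inS a
  topA-restrict zero a b = refl
  topA-restrict (suc h) a b = refl

  topB-restrict : ∀ h a b → topB (restrict h a b) ≡ inS b
  topB-restrict zero a b = refl
  topB-restrict (suc h) a b = refl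

  restrict⊆S : ∀ h a b {x} → x ∈ members a b (restrict h a b) → x ∈ S
  restrict⊆S h a b p with members-∈ (restrict h a b) p
  ... | inj₁ (refl , s) = inS-sound (subst T (topA-restrict h a b) s)
  ... | inj₂ (inj₁ (refl , s)) = inS-sound (subst T (topB-restrict h a b) s)
  restrict⊆S (suc h) a b p | inj₂ (inj₂ q) with ∈-++⁻ (members (2 * a) (2 * b) (restrict h (2 * a) (2 * b))) q
  ... | inj₁ q₀ = restrict⊆S h (2 * a) (2 * b) q₀
  ... | inj₂ q₁ = restrict⊆S h (2 * a + 1) (2 * b + 1) q₁

  module _ (dominated : ∀ v → IsVertex n v → Dominated n S v) where

    module _ {h j a b pa pb : ℕ} (ι : RungIn n h j a b pa pb) where

      flagsA : ∀ {cA} → (∀ {c} → TreeEdge a c → IsVertex n c → c ∈ S → T cA) → T (inS pa ∨ inS b ∨ cA)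
      flagsA child with dominated a (vertexA ι)
      ... | s , s∈S , (_ , vs , adj) with neighboursA ι adj
      ... | inj₁ c = ∨-introʳ {inS pa} (∨-introʳ {inS b} (child c vs s∈S))
      ... | inj₂ (inj₁ s≡pa) = ∨-introˡ (inS-complete s∈S s≡pa)
      ... | inj₂ (inj₂ s≡b) = ∨-introʳ {inS pa} (∨-introˡ (inS-complete s∈S s≡b))

      flagsB : ∀ {cB} → (∀ {c} → TreeEdge b c → IsVertex n c → c ∈ S → T cB) → T (inS pb ∨ inS a ∨ cB)
      flagsB child with dominated b (vertexB ι)
      ... | s , s∈S , (_ , vs , adj) with neighboursB ι adj
      ... | inj₁ c = ∨-introʳ {inS pb} (∨-introʳ {inS a} (child c vs s∈S))
      ... | inj₂ (inj₁ s≡pb) = ∨-introˡ (inS-complete s∈S s≡pb)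
      ... | inj₂ (inj₂ s≡a) = ∨-introʳ {inS pb} (∨-introˡ (inS-complete s∈S s≡a))

    restrict-covered : ∀ h {j a b pa pb} → RungIn n h j a b pa pb → Covered (inS pa) (inS pb) (restrict h a b)
    restrict-covered zero {j} ι =
      Equivalence.from T-∧ (flagsA ι (childless (levelA (rung ι))) , flagsB ι (childless (levelB (rung ι))))
      where
      childless : ∀ {x c} → AtLevel (suc j) x → TreeEdge x c → IsVertex n c → c ∈ S → T false
      childless lv e vc _ = ⊥-elim (bottom-childless ι refl lv vc e)
    restrict-covered (suc h) {a = a} {b} ι =
      Equivalence.from T-∧ (flagsA ι childA , flagsB ι childB) ,
      restrict-covered h (childRungIn₀ ι refl) , restrict-covered h (childRungIn₁ ι refl)
      where
      childA : ∀ {c} → TreeEdge a c → IsVertex n c → c ∈ S →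
               T (topA (restrict h (2 * a) (2 * b)) ∨ topA (restrict h (2 * a + 1) (2 * b + 1)))
      childA e _ c∈S rewrite topA-restrict h (2 * a) (2 * b) | topA-restrict h (2 * a + 1) (2 * b + 1) with e
      ... | inj₁ refl = ∨-introˡ (inS-complete c∈S refl)
      ... | inj₂ refl = ∨-introʳ {inS (2 * a)} (inS-complete c∈S refl)
      childB : ∀ {c} → TreeEdge b c → IsVertex n c → c ∈ S →
               T (topB (restrict h (2 * a) (2 * b)) ∨ topB (restrict h (2 * a + 1) (2 * b + 1)))
      childB e _ c∈S rewrite topB-restrict h (2 * a) (2 * b) | topB-restrict h (2 * a + 1) (2 * b + 1) with e
      ... | inj₁ refl = ∨-introˡ (inS-complete c∈S refl)
      ... | inj₂ refl = ∨-introʳ {inS (2 * b)} (inS-complete c∈S refl)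

    root-flags : T (inS 2 ∨ inS 3)
    root-flags with dominated 1 (root-vertex n)
    ... | s , s∈S , (_ , vs , adj) with root-neighbours {n} vs adj
    ... | inj₁ s≡2 = ∨-introˡ (inS-complete s∈S s≡2)
    ... | inj₂ s≡3 = ∨-introʳ {inS 2} (inS-complete s∈S s≡3)

tds-lowerBound : ∀ h S → Unique S → IsTDS (suc h) S → γtFormula (suc h) ≤ length S
tds-lowerBound h S unique (_ , dominated) = begin
  γtFormula (suc h)                           ≡⟨ formula h ⟩
  base h + rootCost (phase h)                 ≤⟨ ladder-lowerBound (inS 1) t top-flags covered ⟩
  bit (inS 1) + weight t                      ≡⟨ sym size ⟩
  length (onlyIf (inS 1) 1 ++ members 2 3 t)  ≤⟨ unique-⊆-length selected-unique selected⊆S ⟩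
  length S                                    ∎
  where
  open ≤-Reasoning
  open Restriction (suc h) S
  t : Ladder h
  t = restrict h 2 3
  covered : Covered (inS 1) (inS 1) t
  covered = restrict-covered dominated h (topRungIn h)
  top-flags : T (topA t ∨ topB t)
  top-flags = subst₂ (λ x y → T (x ∨ y)) (sym (topA-restrict h 2 3)) (sym (topB-restrict h 2 3)) (root-flags dominated)
  size : length (onlyIf (inS 1) 1 ++ members 2 3 t) ≡ bit (inS 1) + weight t
  size = trans (length-onlyIf (inS 1) 1 _) (cong (bit (inS 1) +_) (length-members t))
  selected-unique : Unique (onlyIf (inS 1) 1 ++ members 2 3 t)
  selected-unique = unique-onlyIf (inS 1) (root∉members t) (members-unique t topRung)
  selected⊆S : ∀ {x} → x ∈ onlyIf (inS 1) 1 ++ members 2 3 t → x ∈ S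
  selected⊆S p with onlyIf-∈ (inS 1) 1 _ p
  ... | inj₁ (refl , s) = inS-sound s
  ... | inj₂ q = restrict⊆S h 2 3 q

-- Upper bound: a covered ladder whose selection lies in S makes S dominate
-- every vertex below the top rung.  childrenA t (childrenB t) records whether
-- a child rung of the top rung has its A-end (B-end) selected.
childrenA childrenB : ∀ {h} → Ladder h → Bool
childrenA (leaf _ _) = false
childrenA (node _ _ t u) = topA t ∨ topA u
childrenB (leaf _ _) = false
childrenB (node _ _ t u) = topB t ∨ topB u

covered-top : ∀ {h pA pB} (t : Ladder h) → Covered pA pB t →
              T (covers pA pB (topA t) (topB t) (childrenA t) (childrenB t))
covered-top (leaf _ _) c = c
covered-top (node _ _ _ _) (c , _) = c

module Domination (n : ℕ) (S : List ℕ) where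

  module _ {h j a b pa pb : ℕ} (ι : RungIn n h j a b pa pb) where

    dominatedA : ∀ {pA sB cA} → T (pA ∨ sB ∨ cA) → (T pA → pa ∈ S) → (T sB → b ∈ S) →
                 (T cA → ∃[ c ] (TreeEdge a c × IsVertex n c × c ∈ S)) → Dominated n S a
    dominatedA {pA} d parent∈ partner∈ child∈ with Equivalence.to (T-∨ {pA}) d
    ... | inj₁ p = pa , parent∈ p , vertexA ι , vertexPA ι , inj₂ (inj₁ (parentA ι))
    ... | inj₂ d′ with Equivalence.to T-∨ d′
    ... | inj₁ s = b , partner∈ s , vertexA ι , vertexB ι , inj₂ (inj₂ (horizontalAB ι))
    ... | inj₂ c with child∈ c
    ... | x , e , vx , x∈S = x , x∈S , vertexA ι , vx , inj₁ e

    dominatedB : ∀ {pB sA cB} → T (pB ∨ sA ∨ cB) → (T pB → pb ∈ S) → (T sA → a ∈ S) →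
                 (T cB → ∃[ c ] (TreeEdge b c × IsVertex n c × c ∈ S)) → Dominated n S b
    dominatedB {pB} d parent∈ partner∈ child∈ with Equivalence.to (T-∨ {pB}) d
    ... | inj₁ p = pb , parent∈ p , vertexB ι , vertexPB ι , inj₂ (inj₁ (parentB ι))
    ... | inj₂ d′ with Equivalence.to T-∨ d′
    ... | inj₁ s = a , partner∈ s , vertexB ι , vertexA ι , inj₂ (inj₂ (horizontalBA ι))
    ... | inj₂ c with child∈ c
    ... | x , e , vx , x∈S = x , x∈S , vertexB ι , vx , inj₁ e

    childA : (t : Ladder h) → (∀ {x} → x ∈ members a b t → x ∈ S) →
             T (childrenA t) → ∃[ c ] (TreeEdge a c × IsVertex n c × c ∈ S)
    childA t@(node _ _ t₀ t₁) sub s with Equivalence.to (T-∨ {topA t₀}) s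
    ... | inj₁ s₀ = 2 * a , inj₁ refl , vertexA (childRungIn₀ ι refl) ,
                    sub (lower⊆members t (∈-++⁺ˡ (∈-membersA {b = 2 * b} t₀ s₀)))
    ... | inj₂ s₁ = 2 * a + 1 , inj₂ refl , vertexA (childRungIn₁ ι refl) ,
                    sub (lower⊆members t (∈-++⁺ʳ (members (2 * a) (2 * b) t₀) (∈-membersA {b = 2 * b + 1} t₁ s₁)))

    childB : (t : Ladder h) → (∀ {x} → x ∈ members a b t → x ∈ S) →
             T (childrenB t) → ∃[ c ] (TreeEdge b c × IsVertex n c × c ∈ S)
    childB t@(node _ _ t₀ t₁) sub s with Equivalence.to (T-∨ {topB t₀}) s
    ... | inj₁ s₀ = 2 * b , inj₁ refl , vertexB (childRungIn₀ ι refl) ,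
                    sub (lower⊆members t (∈-++⁺ˡ (∈-membersB {a = 2 * a} t₀ s₀)))
    ... | inj₂ s₁ = 2 * b + 1 , inj₂ refl , vertexB (childRungIn₁ ι refl) ,
                    sub (lower⊆members t (∈-++⁺ʳ (members (2 * a) (2 * b) t₀) (∈-membersB {a = 2 * a + 1} t₁ s₁)))

  covered⇒dominated : ∀ {h j a b pa pb} → RungIn n h j a b pa pb → (t : Ladder h) → ∀ {pA pB} → Covered pA pB t →
                      (T pA → pa ∈ S) → (T pB → pb ∈ S) → (∀ {x} → x ∈ members a b t → x ∈ S) →
                      ∀ {x} → x ∈ members a b (full h) → Dominated n S x
  lower-dominated : ∀ {h j a b pa pb} → RungIn n h j a b pa pb → (t : Ladder h) → ∀ {pA pB} → Covered pA pB t →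
                    (∀ {x} → x ∈ members a b t → x ∈ S) → ∀ {x} → x ∈ lower a b (full h) → Dominated n S x

  covered⇒dominated {h} ι t c parentA∈ parentB∈ sub p
    with members-∈ (full h) p | Equivalence.to T-∧ (covered-top t c)
  ... | inj₁ (refl , _) | coverA , _ =
    dominatedA ι coverA parentA∈ (λ s → sub (∈-membersB t s)) (childA ι t sub)
  ... | inj₂ (inj₁ (refl , _)) | _ , coverB =
    dominatedB ι coverB parentB∈ (λ s → sub (∈-membersA t s)) (childB ι t sub)
  ... | inj₂ (inj₂ q) | _ = lower-dominated ι t c sub q

  lower-dominated {suc h} {a = a} {b} ι t@(node _ _ t₀ t₁) (_ , c₀ , c₁) sub q
    with ∈-++⁻ (members (2 * a) (2 * b) (full h)) q
  ... | inj₁ q₀ = covered⇒dominated (childRungIn₀ ι refl) t₀ c₀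
                    (λ s → sub (∈-membersA t s)) (λ s → sub (∈-membersB t s))
                    (λ m → sub (lower⊆members t (∈-++⁺ˡ m))) q₀
  ... | inj₂ q₁ = covered⇒dominated (childRungIn₁ ι refl) t₁ c₁
                    (λ s → sub (∈-membersA t s)) (λ s → sub (∈-membersB t s))
                    (λ m → sub (lower⊆members t (∈-++⁺ʳ (members (2 * a) (2 * b) t₀) m))) q₁

module Construction (h : ℕ) where

  r : Phase
  r = phase h

  ladder : Ladder h
  ladder = periodic h true (topFlagB r)

  optimal : List ℕ
  optimal = onlyIf (rootFlag r) 1 ++ members 2 3 ladder

  optimal-unique : Unique optimal
  optimal-unique = unique-onlyIf (rootFlag r) (root∉members ladder) (members-unique ladder topRung)

  optimal-length : length optimal ≡ γtFormula (suc h)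
  optimal-length = begin
    length optimal                    ≡⟨ length-onlyIf (rootFlag r) 1 _ ⟩
    bit (rootFlag r) + length (members 2 3 ladder) ≡⟨ cong (bit (rootFlag r) +_) (length-members ladder) ⟩
    bit (rootFlag r) + weight ladder  ≡⟨ proj₂ (proj₂ (ladder-optimum h)) ⟩
    base h + rootCost r               ≡⟨ sym (formula h) ⟩
    γtFormula (suc h)                 ∎
    where open ≡-Reasoning

  optimal-TDS : IsTDS (suc h) optimal
  optimal-TDS = vertices , dominated
    where
    open Domination (suc h) optimal
    vertices : ∀ s → s ∈ optimal → IsVertex (suc h) s
    vertices s p with onlyIf-∈ (rootFlag r) 1 _ p
    ... | inj₁ (refl , _) = root-vertex (suc h)
    ... | inj₂ q = members-vertex ladder topRung ≤-refl q
    in-ladder : ∀ {x} → x ∈ members 2 3 ladder → x ∈ optimal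
    in-ladder = ∈-++⁺ʳ (onlyIf (rootFlag r) 1)
    dominated : ∀ v → IsVertex (suc h) v → Dominated (suc h) optimal v
    dominated v (1≤v , _) with v <? 2
    ... | yes v<2 rewrite ≤-antisym (≤-pred v<2) 1≤v =
      2 , in-ladder (∈-membersA ladder (subst T (sym (topA-periodic h true (topFlagB r))) tt)) ,
      root-vertex (suc h) , vertexA (topRungIn h) , inj₁ (inj₁ refl)
    dominated v vv | no v≮2 with below-top-rung h v (≮⇒≥ v≮2) (vertex⇒bound {suc h} vv)
    ... | k , k≤h , anc =
      covered⇒dominated (topRungIn h) ladder (proj₁ (proj₂ (ladder-optimum h)))
        (∈-onlyIf 1 _) (∈-onlyIf 1 _) in-ladder (below⇒full h k k≤h anc)

theorem2 : (n : ℕ) → 1 ≤ n → TotalDominationNumber n (γtFormula n)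
theorem2 (suc h) _ =
  (optimal , optimal-unique , optimal-TDS , optimal-length) ,
  λ S unique tds → tds-lowerBound h S unique tds
  where open Construction h
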